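{- (i) For every finite multiset $\Gamma$ of formulas and every formula $\varphi$: $\vdash_{\mathsf{G4CK}}\Gamma\Rightarrow\varphi$ if and only if $\Gamma\vdash\varphi$ is derivable in $\mathsf{CKH}$ (with $\Gamma$ regarded as the set of its elements). (ii) For every finite multiset $\Gamma$ and every multiset $\Delta$ with $|\Delta|\le 1$: $\vdash_{\mathsf{G4WK}}\Gamma\Rightarrow\Delta$ if and only if $\Gamma\vdash\delta$ is derivable in $\mathsf{WKH}$, where $\delta$ is the unique element of $\Delta$ if $\Delta$ is nonempty and $\delta=\bot$ if $\Delta=\emptyset$.
   Context: Formulas are built from a countably infinite set $\mathsf{Prop}$ of propositional variables by $\varphi ::= p \mid \bot \mid \varphi\wedge\varphi \mid \varphi\vee\varphi \mid \varphi\to\varphi \mid \Box\varphi \mid \Diamond\varphi$; $\neg\varphi:=\varphi\to\bot$. For a multiset $\Gamma$, $\Box^{ -1}\Gamma=\{\varphi\mid\Box\varphi\in\Gamma\}$ and $\Diamond^{ -1}\Gamma=\{\varphi\mid\Diamond\varphi\in\Gamma\}$ (with multiplicities). Sequent calculi: a sequent is $\Gamma\Rightarrow\Delta$ with $\Gamma,\Delta$ finite multisets; $\Gamma,\varphi$ means $\Gamma\uplus\{\varphi\}$; a single formula on the right denotes a singleton. In $\mathsf{G4CK}$ succedents have exactly one element; in $\mathsf{G4WK}$ at most one. Common rules ($p\in\mathsf{Prop}$, $\Delta$ an allowed succedent): ($\bot$L) $\Gamma,\bot\Rightarrow\Delta$ (no premises); (IdP) $\Gamma,p\Rightarrow p$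 (no premises); ($\wedge$L) from $\Gamma,\varphi,\psi\Rightarrow\Delta$ infer $\Gamma,\varphi\wedge\psi\Rightarrow\Delta$; ($\wedge$R) from $\Gamma\Rightarrow\varphi$, $\Gamma\Rightarrow\psi$ infer $\Gamma\Rightarrow\varphi\wedge\psi$; ($\vee$L) from $\Gamma,\varphi\Rightarrow\Delta$, $\Gamma,\psi\Rightarrow\Delta$ infer $\Gamma,\varphi\vee\psi\Rightarrow\Delta$; ($\vee$R$_i$) from $\Gamma\Rightarrow\varphi_i$ infer $\Gamma\Rightarrow\varphi_1\vee\varphi_2$; ($\to$R) from $\Gamma,\varphi\Rightarrow\psi$ infer $\Gamma\Rightarrow\varphi\to\psi$; ($\wedge\!\to$L) from $\Gamma,\varphi\to(\psi\to\chi)\Rightarrow\Delta$ infer $\Gamma,(\varphi\wedge\psi)\to\chi\Rightarrow\Delta$; ($\vee\!\to$L) from $\Gamma,\varphi\to\chi,\psi\to\chi\Rightarrow\Delta$ infer $\Gamma,(\varphi\vee\psi)\to\chi\Rightarrow\Delta$; ($p\!\to$L) from $\Gamma,p,\varphi\Rightarrow\Delta$ infer $\Gamma,p,p\to\varphi\Rightarrow\Delta$; ($\to\to$L) from $\Gamma,\psi\to\chi\Rightarrow\varphi\to\psi$ and $\Gamma,\chi\Rightarrow\Delta$ infer $\Gamma,(\varphi\to\psi)\to\chi\Rightarrow\Delta$; ($\Box$R) from $\Box^{ -1}\Gamma\Rightarrow\varphi$ infer $\Gamma\Rightarrow\Box\varphi$; ($\Box\!\to$L) from $\Box^{ -1}\Gamma\Rightarrow\varphi$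 and $\Gamma,\psi\Rightarrow\Delta$ infer $\Gamma,\Box\varphi\to\psi\Rightarrow\Delta$; ($\Diamond\!\to$L) from $\Box^{ -1}\Gamma,\gamma\Rightarrow\varphi$ and $\Gamma,\Diamond\gamma,\psi\Rightarrow\Delta$ infer $\Gamma,\Diamond\gamma,\Diamond\varphi\to\psi\Rightarrow\Delta$. $\mathsf{G4CK}$ additionally has ($\Diamond$L): from $\Box^{ -1}\Gamma,\varphi\Rightarrow\psi$ infer $\Gamma,\Diamond\varphi\Rightarrow\Diamond\psi$; $\mathsf{G4WK}$ instead has ($\Diamond$L$'$): from $\Box^{ -1}\Gamma,\varphi\Rightarrow\Diamond^{ -1}\Delta$ infer $\Gamma,\Diamond\varphi\Rightarrow\Delta$. $\vdash_{\mathsf{S}}\Gamma\Rightarrow\Delta$ means a finite derivation exists in $\mathsf{S}$. Hilbert calculi: $\mathsf{CKH}$ derives consecutions $\Gamma\vdash\varphi$ ($\Gamma$ a set) by: $\Gamma\vdash\varphi$ for $\varphi$ an axiom instance; $\Gamma\vdash\varphi$ for $\varphi\in\Gamma$; from $\emptyset\vdash\varphi$ infer $\Gamma\vdash\Box\varphi$; from $\Gamma\vdash\varphi$ and $\Gamma\vdash\varphi\to\psi$ infer $\Gamma\vdash\psi$. Axioms of $\mathsf{CKH}$: all instances of $\varphi\to(\psi\to\varphi)$; $(\varphi\to(\psi\to\chi))\to((\varphi\to\psi)\to(\varphi\to\chi))$; $\varphi\to(\varphi\vee\psi)$; $\psi\to(\varphi\vee\psi)$; $(\varphi\to\chi)\to((\psi\to\chi)\to((\varphi\vee\psi)\to\chi))$;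 $(\varphi\wedge\psi)\to\varphi$; $(\varphi\wedge\psi)\to\psi$; $(\varphi\to\psi)\to((\varphi\to\chi)\to(\varphi\to(\psi\wedge\chi)))$; $\bot\to\varphi$; $\Box(\varphi\to\psi)\to(\Box\varphi\to\Box\psi)$; $\Box(\varphi\to\psi)\to(\Diamond\varphi\to\Diamond\psi)$. $\mathsf{WKH}$ is $\mathsf{CKH}$ with the additional axiom $\neg\Diamond\bot$. -}

module Defs where

open import Data.Nat using (ℕ)
open import Data.List using (List; []; _∷_)
open import Data.Maybe using (Maybe; just; nothing)
open import Data.List.Membership.Propositional using (_∈_)
open import Data.List.Relation.Binary.Permutation.Propositional using (_↭_)

infixr 6 _⇒_
infixl 7 _∨_
infixl 8 _∧_
data Fm : Set where
  var  : ℕ → Fm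
  ⊥'   : Fm
  _∧_  : Fm → Fm → Fm
  _∨_  : Fm → Fm → Fm
  _⇒_  : Fm → Fm → Fm
  □    : Fm → Fm
  ◇    : Fm → Fm

¬' : Fm → Fm
¬' φ = φ ⇒ ⊥'

-- Multisets are represented by lists; every rule's conclusion antecedent is
-- taken up to permutation (_↭_), so derivability is a property of multisets.

box⁻¹ : List Fm → List Fm
box⁻¹ []          = []
box⁻¹ (□ φ ∷ Γ)   = φ ∷ box⁻¹ Γ
box⁻¹ (var _ ∷ Γ) = box⁻¹ Γ
box⁻¹ (⊥' ∷ Γ)    = box⁻¹ Γ
box⁻¹ (_ ∧ _ ∷ Γ) = box⁻¹ Γ
box⁻¹ (_ ∨ _ ∷ Γ) = box⁻¹ Γ
box⁻¹ (_ ⇒ _ ∷ Γ) = box⁻¹ Γ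
box⁻¹ (◇ _ ∷ Γ)   = box⁻¹ Γ

dia⁻¹ : Maybe Fm → Maybe Fm
dia⁻¹ (just (◇ φ)) = just φ
dia⁻¹ _            = nothing

data G4CK : List Fm → Fm → Set where
  ⊥L   : ∀ {Γ' Γ δ} → Γ' ↭ (⊥' ∷ Γ) → G4CK Γ' δ
  IdP  : ∀ {Γ' Γ p} → Γ' ↭ (var p ∷ Γ) → G4CK Γ' (var p)
  ∧L   : ∀ {Γ' Γ φ ψ δ} → Γ' ↭ (φ ∧ ψ ∷ Γ) → G4CK (φ ∷ ψ ∷ Γ) δ → G4CK Γ' δ
  ∧R   : ∀ {Γ φ ψ} → G4CK Γ φ → G4CK Γ ψ → G4CK Γ (φ ∧ ψ)
  ∨L   : ∀ {Γ' Γ φ ψ δ} → Γ' ↭ (φ ∨ ψ ∷ Γ) → G4CK (φ ∷ Γ) δ → G4CK (ψ ∷ Γ) δ → G4CK Γ' δ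
  ∨R₁  : ∀ {Γ φ ψ} → G4CK Γ φ → G4CK Γ (φ ∨ ψ)
  ∨R₂  : ∀ {Γ φ ψ} → G4CK Γ ψ → G4CK Γ (φ ∨ ψ)
  ⇒R   : ∀ {Γ φ ψ} → G4CK (φ ∷ Γ) ψ → G4CK Γ (φ ⇒ ψ)
  ∧⇒L  : ∀ {Γ' Γ φ ψ χ δ} → Γ' ↭ ((φ ∧ ψ) ⇒ χ ∷ Γ) → G4CK (φ ⇒ (ψ ⇒ χ) ∷ Γ) δ → G4CK Γ' δ
  ∨⇒L  : ∀ {Γ' Γ φ ψ χ δ} → Γ' ↭ ((φ ∨ ψ) ⇒ χ ∷ Γ) → G4CK (φ ⇒ χ ∷ ψ ⇒ χ ∷ Γ) δ → G4CK Γ' δ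
  p⇒L  : ∀ {Γ' Γ p φ δ} → Γ' ↭ (var p ∷ var p ⇒ φ ∷ Γ) → G4CK (var p ∷ φ ∷ Γ) δ → G4CK Γ' δ
  ⇒⇒L  : ∀ {Γ' Γ φ ψ χ δ} → Γ' ↭ ((φ ⇒ ψ) ⇒ χ ∷ Γ) → G4CK (ψ ⇒ χ ∷ Γ) (φ ⇒ ψ) → G4CK (χ ∷ Γ) δ → G4CK Γ' δ
  □R   : ∀ {Γ φ} → G4CK (box⁻¹ Γ) φ → G4CK Γ (□ φ)
  □⇒L  : ∀ {Γ' Γ φ ψ δ} → Γ' ↭ (□ φ ⇒ ψ ∷ Γ) → G4CK (box⁻¹ Γ) φ → G4CK (ψ ∷ Γ) δ → G4CK Γ' δ
  ◇⇒L  : ∀ {Γ' Γ γ φ ψ δ} → Γ' ↭ (◇ γ ∷ ◇ φ ⇒ ψ ∷ Γ) → G4CK (γ ∷ box⁻¹ Γ) φ → G4CK (◇ γ ∷ ψ ∷ Γ) δ → G4CK Γ' δ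
  ◇L   : ∀ {Γ' Γ φ ψ} → Γ' ↭ (◇ φ ∷ Γ) → G4CK (φ ∷ box⁻¹ Γ) ψ → G4CK Γ' (◇ ψ)

-- Sequent calculus G4WK (succedents with at most one formula, as Maybe Fm)
data G4WK : List Fm → Maybe Fm → Set where
  ⊥L   : ∀ {Γ' Γ Δ} → Γ' ↭ (⊥' ∷ Γ) → G4WK Γ' Δ
  IdP  : ∀ {Γ' Γ p} → Γ' ↭ (var p ∷ Γ) → G4WK Γ' (just (var p))
  ∧L   : ∀ {Γ' Γ φ ψ Δ} → Γ' ↭ (φ ∧ ψ ∷ Γ) → G4WK (φ ∷ ψ ∷ Γ) Δ → G4WK Γ' Δ
  ∧R   : ∀ {Γ φ ψ} → G4WK Γ (just φ) → G4WK Γ (just ψ) → G4WK Γ (just (φ ∧ ψ))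
  ∨L   : ∀ {Γ' Γ φ ψ Δ} → Γ' ↭ (φ ∨ ψ ∷ Γ) → G4WK (φ ∷ Γ) Δ → G4WK (ψ ∷ Γ) Δ → G4WK Γ' Δ
  ∨R₁  : ∀ {Γ φ ψ} → G4WK Γ (just φ) → G4WK Γ (just (φ ∨ ψ))
  ∨R₂  : ∀ {Γ φ ψ} → G4WK Γ (just ψ) → G4WK Γ (just (φ ∨ ψ))
  ⇒R   : ∀ {Γ φ ψ} → G4WK (φ ∷ Γ) (just ψ) → G4WK Γ (just (φ ⇒ ψ))
  ∧⇒L  : ∀ {Γ' Γ φ ψ χ Δ} → Γ' ↭ ((φ ∧ ψ) ⇒ χ ∷ Γ) → G4WK (φ ⇒ (ψ ⇒ χ) ∷ Γ) Δ → G4WK Γ' Δ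
  ∨⇒L  : ∀ {Γ' Γ φ ψ χ Δ} → Γ' ↭ ((φ ∨ ψ) ⇒ χ ∷ Γ) → G4WK (φ ⇒ χ ∷ ψ ⇒ χ ∷ Γ) Δ → G4WK Γ' Δ
  p⇒L  : ∀ {Γ' Γ p φ Δ} → Γ' ↭ (var p ∷ var p ⇒ φ ∷ Γ) → G4WK (var p ∷ φ ∷ Γ) Δ → G4WK Γ' Δ
  ⇒⇒L  : ∀ {Γ' Γ φ ψ χ Δ} → Γ' ↭ ((φ ⇒ ψ) ⇒ χ ∷ Γ) → G4WK (ψ ⇒ χ ∷ Γ) (just (φ ⇒ ψ)) → G4WK (χ ∷ Γ) Δ → G4WK Γ' Δ
  □R   : ∀ {Γ φ} → G4WK (box⁻¹ Γ) (just φ) → G4WK Γ (just (□ φ))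
  □⇒L  : ∀ {Γ' Γ φ ψ Δ} → Γ' ↭ (□ φ ⇒ ψ ∷ Γ) → G4WK (box⁻¹ Γ) (just φ) → G4WK (ψ ∷ Γ) Δ → G4WK Γ' Δ
  ◇⇒L  : ∀ {Γ' Γ γ φ ψ Δ} → Γ' ↭ (◇ γ ∷ ◇ φ ⇒ ψ ∷ Γ) → G4WK (γ ∷ box⁻¹ Γ) (just φ) → G4WK (◇ γ ∷ ψ ∷ Γ) Δ → G4WK Γ' Δ
  ◇L'  : ∀ {Γ' Γ φ Δ} → Γ' ↭ (◇ φ ∷ Γ) → G4WK (φ ∷ box⁻¹ Γ) (dia⁻¹ Δ) → G4WK Γ' Δ

data CKAx : Fm → Set where
  K1  : ∀ {φ ψ} → CKAx (φ ⇒ (ψ ⇒ φ))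
  K2  : ∀ {φ ψ χ} → CKAx ((φ ⇒ (ψ ⇒ χ)) ⇒ ((φ ⇒ ψ) ⇒ (φ ⇒ χ)))
  D1  : ∀ {φ ψ} → CKAx (φ ⇒ (φ ∨ ψ))
  D2  : ∀ {φ ψ} → CKAx (ψ ⇒ (φ ∨ ψ))
  D3  : ∀ {φ ψ χ} → CKAx ((φ ⇒ χ) ⇒ ((ψ ⇒ χ) ⇒ ((φ ∨ ψ) ⇒ χ)))
  C1  : ∀ {φ ψ} → CKAx ((φ ∧ ψ) ⇒ φ)
  C2  : ∀ {φ ψ} → CKAx ((φ ∧ ψ) ⇒ ψ)
  C3  : ∀ {φ ψ χ} → CKAx ((φ ⇒ ψ) ⇒ ((φ ⇒ χ) ⇒ (φ ⇒ (ψ ∧ χ))))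
  EFQ : ∀ {φ} → CKAx (⊥' ⇒ φ)
  K□  : ∀ {φ ψ} → CKAx (□ (φ ⇒ ψ) ⇒ (□ φ ⇒ □ ψ))
  K◇  : ∀ {φ ψ} → CKAx (□ (φ ⇒ ψ) ⇒ (◇ φ ⇒ ◇ ψ))

data WKAx : Fm → Set where
  ck  : ∀ {φ} → CKAx φ → WKAx φ
  N◇  : WKAx (¬' (◇ ⊥'))

-- Hilbert consequence relation Γ ⊢ φ over an axiom set; Γ is (the set of
-- elements of) a list, accessed by membership.
data Hilbert (Ax : Fm → Set) (Γ : List Fm) : Fm → Set where
  ax  : ∀ {φ} → Ax φ → Hilbert Ax Γ φ
  hyp : ∀ {φ} → φ ∈ Γ → Hilbert Ax Γ φ
  nec : ∀ {φ} → Hilbert Ax [] φ → Hilbert Ax Γ (□ φ)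
  mp  : ∀ {φ ψ} → Hilbert Ax Γ φ → Hilbert Ax Γ (φ ⇒ ψ) → Hilbert Ax Γ ψ

CKH : List Fm → Fm → Set
CKH = Hilbert CKAx

WKH : List Fm → Fm → Set
WKH = Hilbert WKAx

succ-fm : Maybe Fm → Fm
succ-fm (just δ) = δ
succ-fm nothing  = ⊥'

-- Soundness: every G4 rule is admissible in the Hilbert calculus, using the deduction
-- theorem and the K axioms; in WK, ◇L' with a succedent other than ◇ψ turns the premise into
-- a proof of ◇⊥, which ¬◇⊥ refutes.
--
-- Completeness goes through a Kleene-style calculus G3 that keeps principal formulas, so that
-- contexts behave as sets. There cut is admissible by a plain structural induction, hence
-- Hilbert derivations translate into G3, modus ponens being a cut. Conversely the last rule of
-- a G3-derivation always points to an applicable G4 rule; the premises of that rule are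
-- G3-derivable by cuts against small derivations (inversion) and have smaller Dyckhoff weight,
-- so induction on the weight turns G3-derivations into G4-derivations.

module Submission where

open import Defs
open import Data.Empty using (⊥-elim)
open import Data.List using (List; []; _∷_; _++_; map; fromMaybe)
open import Data.List.Properties using (map-++)
open import Data.List.Membership.Propositional using (_∈_)
open import Data.List.Membership.Propositional.Properties using (∈-∃++)
open import Data.List.Relation.Unary.Any using (here; there)
open import Data.List.Relation.Binary.Subset.Propositional using (_⊆_)
open import Data.List.Relation.Binary.Subset.Propositional.Properties
  using (⊆-refl; ⊆-trans; ⊆-reflexive-↭; ∷⁺ʳ; xs⊆ys++xs)
open import Data.List.Relation.Binary.Permutation.Propositional
  using (_↭_; ↭-refl; ↭-sym; ↭-trans; prep; swap)
open import Data.List.Relation.Binary.Permutation.Propositional.Properties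
  using (∈-resp-↭; shift; ++⁺ʳ) renaming (map⁺ to ↭-map⁺)
open import Data.Maybe using (Maybe; just; nothing)
open import Data.Nat using (ℕ; suc; _+_; _^_; _≤_; _<_; z≤n; s≤s)
open import Data.Nat.Induction using (<-wellFounded)
open import Data.Nat.ListAction using (sum)
open import Data.Nat.ListAction.Properties using (sum-++; sum-↭)
open import Data.Nat.Properties
  using (≤-refl; ≤-reflexive; ≤-trans; <-trans; ≤-<-trans; <⇒≤; m<n⇒m<1+n; m≤m+n; m≤n+m; m<m+n
        ; m≤n⇒m≤o+n; +-suc; +-assoc; +-comm; +-identityʳ; +-mono-≤; +-monoˡ-≤; +-monoʳ-≤
        ; +-mono-<; +-monoˡ-<; +-monoʳ-<; +-mono-≤-<; +-mono-<-≤; ^-monoʳ-≤; m^n>0; module ≤-Reasoning)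
open import Data.Product using (_×_; _,_; ∃-syntax)
open import Function.Base using (_∘_)
open import Function.Bundles using (_⇔_; mk⇔)
open import Induction.WellFounded using (Acc; acc)
open import Relation.Binary.PropositionalEquality
  using (_≡_; _≢_; refl; sym; trans; cong; subst; subst₂)

private variable
  p : ℕ
  φ ψ χ γ θ : Fm
  Γ Γ' Γ₀ Γ₁ Γ₂ Ξ : List Fm
  Δ : Maybe Fm

pattern ∈₀ = here refl
pattern ∈₁ = there ∈₀
pattern ∈₂ = there ∈₁
pattern ∈₃ = there ∈₂

⊆-∷ : Γ ⊆ Γ' → Γ ⊆ φ ∷ Γ'
⊆-∷ Γ⊆Γ' φ∈Γ = there (Γ⊆Γ' φ∈Γ)

∷-swap-⊆ : φ ∷ ψ ∷ Γ ⊆ ψ ∷ φ ∷ Γ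
∷-swap-⊆ = ⊆-reflexive-↭ (swap _ _ ↭-refl)

++-shift-⊆ : ∀ Θ → Θ ++ φ ∷ Γ ⊆ φ ∷ Θ ++ Γ
++-shift-⊆ Θ = ⊆-reflexive-↭ (shift _ Θ _)

⊆-∷₂ : Γ ⊆ φ ∷ Γ' → Γ ⊆ φ ∷ ψ ∷ Γ'
⊆-∷₂ s = ⊆-trans s (∷⁺ʳ _ (⊆-∷ ⊆-refl))

⊆-∷-under : Γ ⊆ φ ∷ Γ' → ψ ∷ Γ ⊆ φ ∷ ψ ∷ Γ'
⊆-∷-under s = ⊆-trans (∷⁺ʳ _ s) ∷-swap-⊆

□∈⇒∈box⁻¹ : □ φ ∈ Γ → φ ∈ box⁻¹ Γ
□∈⇒∈box⁻¹ {Γ = □ _ ∷ _}     ∈₀        = ∈₀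
□∈⇒∈box⁻¹ {Γ = □ _ ∷ _}     (there i) = there (□∈⇒∈box⁻¹ i)
□∈⇒∈box⁻¹ {Γ = var _ ∷ _}   (there i) = □∈⇒∈box⁻¹ i
□∈⇒∈box⁻¹ {Γ = ⊥' ∷ _}      (there i) = □∈⇒∈box⁻¹ i
□∈⇒∈box⁻¹ {Γ = _ ∧ _ ∷ _}   (there i) = □∈⇒∈box⁻¹ i
□∈⇒∈box⁻¹ {Γ = _ ∨ _ ∷ _}   (there i) = □∈⇒∈box⁻¹ i
□∈⇒∈box⁻¹ {Γ = _ ⇒ _ ∷ _}   (there i) = □∈⇒∈box⁻¹ i
□∈⇒∈box⁻¹ {Γ = ◇ _ ∷ _}     (there i) = □∈⇒∈box⁻¹ i

∈box⁻¹⇒□∈ : φ ∈ box⁻¹ Γ → □ φ ∈ Γ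
∈box⁻¹⇒□∈ {Γ = □ _ ∷ _}   ∈₀        = ∈₀
∈box⁻¹⇒□∈ {Γ = □ _ ∷ _}   (there i) = there (∈box⁻¹⇒□∈ i)
∈box⁻¹⇒□∈ {Γ = var _ ∷ _} i         = there (∈box⁻¹⇒□∈ i)
∈box⁻¹⇒□∈ {Γ = ⊥' ∷ _}    i         = there (∈box⁻¹⇒□∈ i)
∈box⁻¹⇒□∈ {Γ = _ ∧ _ ∷ _} i         = there (∈box⁻¹⇒□∈ i)
∈box⁻¹⇒□∈ {Γ = _ ∨ _ ∷ _} i         = there (∈box⁻¹⇒□∈ i)
∈box⁻¹⇒□∈ {Γ = _ ⇒ _ ∷ _} i         = there (∈box⁻¹⇒□∈ i)
∈box⁻¹⇒□∈ {Γ = ◇ _ ∷ _}   i         = there (∈box⁻¹⇒□∈ i)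

box⁻¹-mono : Γ ⊆ Γ' → box⁻¹ Γ ⊆ box⁻¹ Γ'
box⁻¹-mono Γ⊆Γ' i = □∈⇒∈box⁻¹ (Γ⊆Γ' (∈box⁻¹⇒□∈ i))

∈⇒↭∷ : φ ∈ Γ → ∃[ Γ₀ ] Γ ↭ φ ∷ Γ₀
∈⇒↭∷ φ∈Γ with ys , zs , refl ← ∈-∃++ φ∈Γ = ys ++ zs , shift _ ys zs

∈₂⇒↭∷∷ : φ ∈ Γ → ψ ∈ Γ → φ ≢ ψ → ∃[ Γ₀ ] Γ ↭ φ ∷ ψ ∷ Γ₀
∈₂⇒↭∷∷ φ∈Γ ψ∈Γ φ≢ψ with Γ₁ , Γ↭φΓ₁ ← ∈⇒↭∷ φ∈Γ with ∈-resp-↭ Γ↭φΓ₁ ψ∈Γ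
... | here ψ≡φ     = ⊥-elim (φ≢ψ (sym ψ≡φ))
... | there ψ∈Γ₁ with Γ₀ , Γ₁↭ψΓ₀ ← ∈⇒↭∷ ψ∈Γ₁ = Γ₀ , ↭-trans Γ↭φΓ₁ (prep _ Γ₁↭ψΓ₀)

↭∷⇒∈ : Γ ↭ φ ∷ Γ₀ → φ ∈ Γ
↭∷⇒∈ Γ↭ = ⊆-reflexive-↭ (↭-sym Γ↭) ∈₀

↭∷⇒⊆ : Γ ↭ φ ∷ Γ₀ → Γ₀ ⊆ Γ
↭∷⇒⊆ Γ↭ = ⊆-trans (⊆-∷ ⊆-refl) (⊆-reflexive-↭ (↭-sym Γ↭))

↭∷∷⇒⊆ : Γ ↭ φ ∷ ψ ∷ Γ₀ → φ ∷ Γ₀ ⊆ Γ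
↭∷∷⇒⊆ Γ↭ ∈₀        = ↭∷⇒∈ Γ↭
↭∷∷⇒⊆ Γ↭ (there i) = ⊆-reflexive-↭ (↭-sym Γ↭) (there (there i))

data Logic : Set where
  CK WK : Logic

private variable
  L : Logic

-- The side condition of the rule ◇L: in CK only the succedent ◇ψ is allowed
-- (rule ◇L of G4CK); in WK every succedent is allowed (rule ◇L' of G4WK).
data ◇L-Allowed : Logic → Maybe Fm → Set where
  WK-any      : ◇L-Allowed WK Δ
  ◇-succedent : ◇L-Allowed L (just (◇ φ))

Axiom : Logic → Fm → Set
Axiom CK = CKAx
Axiom WK = WKAx

CKAx⇒Axiom : CKAx φ → Axiom L φ
CKAx⇒Axiom {L = CK} a = a
CKAx⇒Axiom {L = WK} a = ck a

data G4 (L : Logic) : List Fm → Maybe Fm → Set where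
  ⊥L   : Γ' ↭ ⊥' ∷ Γ → G4 L Γ' Δ
  IdP  : Γ' ↭ var p ∷ Γ → G4 L Γ' (just (var p))
  ∧L   : Γ' ↭ φ ∧ ψ ∷ Γ → G4 L (φ ∷ ψ ∷ Γ) Δ → G4 L Γ' Δ
  ∧R   : G4 L Γ (just φ) → G4 L Γ (just ψ) → G4 L Γ (just (φ ∧ ψ))
  ∨L   : Γ' ↭ φ ∨ ψ ∷ Γ → G4 L (φ ∷ Γ) Δ → G4 L (ψ ∷ Γ) Δ → G4 L Γ' Δ
  ∨R₁  : G4 L Γ (just φ) → G4 L Γ (just (φ ∨ ψ))
  ∨R₂  : G4 L Γ (just ψ) → G4 L Γ (just (φ ∨ ψ))
  ⇒R   : G4 L (φ ∷ Γ) (just ψ) → G4 L Γ (just (φ ⇒ ψ))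
  ∧⇒L  : Γ' ↭ (φ ∧ ψ) ⇒ χ ∷ Γ → G4 L (φ ⇒ (ψ ⇒ χ) ∷ Γ) Δ → G4 L Γ' Δ
  ∨⇒L  : Γ' ↭ (φ ∨ ψ) ⇒ χ ∷ Γ → G4 L (φ ⇒ χ ∷ ψ ⇒ χ ∷ Γ) Δ → G4 L Γ' Δ
  p⇒L  : Γ' ↭ var p ∷ var p ⇒ φ ∷ Γ → G4 L (var p ∷ φ ∷ Γ) Δ → G4 L Γ' Δ
  ⇒⇒L  : Γ' ↭ (φ ⇒ ψ) ⇒ χ ∷ Γ → G4 L (ψ ⇒ χ ∷ Γ) (just (φ ⇒ ψ)) → G4 L (χ ∷ Γ) Δ → G4 L Γ' Δ
  □R   : G4 L (box⁻¹ Γ) (just φ) → G4 L Γ (just (□ φ))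
  □⇒L  : Γ' ↭ □ φ ⇒ ψ ∷ Γ → G4 L (box⁻¹ Γ) (just φ) → G4 L (ψ ∷ Γ) Δ → G4 L Γ' Δ
  ◇⇒L  : Γ' ↭ ◇ γ ∷ ◇ φ ⇒ ψ ∷ Γ → G4 L (γ ∷ box⁻¹ Γ) (just φ) → G4 L (◇ γ ∷ ψ ∷ Γ) Δ → G4 L Γ' Δ
  ◇L   : Γ' ↭ ◇ φ ∷ Γ → G4 L (φ ∷ box⁻¹ Γ) (dia⁻¹ Δ) → ◇L-Allowed L Δ → G4 L Γ' Δ

G4CK⇒G4 : G4CK Γ φ → G4 CK Γ (just φ)
G4CK⇒G4 (G4CK.⊥L ρ)       = ⊥L ρ
G4CK⇒G4 (G4CK.IdP ρ)      = IdP ρ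
G4CK⇒G4 (G4CK.∧L ρ d)     = ∧L ρ (G4CK⇒G4 d)
G4CK⇒G4 (G4CK.∧R d e)     = ∧R (G4CK⇒G4 d) (G4CK⇒G4 e)
G4CK⇒G4 (G4CK.∨L ρ d e)   = ∨L ρ (G4CK⇒G4 d) (G4CK⇒G4 e)
G4CK⇒G4 (G4CK.∨R₁ d)      = ∨R₁ (G4CK⇒G4 d)
G4CK⇒G4 (G4CK.∨R₂ d)      = ∨R₂ (G4CK⇒G4 d)
G4CK⇒G4 (G4CK.⇒R d)       = ⇒R (G4CK⇒G4 d)
G4CK⇒G4 (G4CK.∧⇒L ρ d)    = ∧⇒L ρ (G4CK⇒G4 d)
G4CK⇒G4 (G4CK.∨⇒L ρ d)    = ∨⇒L ρ (G4CK⇒G4 d)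
G4CK⇒G4 (G4CK.p⇒L ρ d)    = p⇒L ρ (G4CK⇒G4 d)
G4CK⇒G4 (G4CK.⇒⇒L ρ d e)  = ⇒⇒L ρ (G4CK⇒G4 d) (G4CK⇒G4 e)
G4CK⇒G4 (G4CK.□R d)       = □R (G4CK⇒G4 d)
G4CK⇒G4 (G4CK.□⇒L ρ d e)  = □⇒L ρ (G4CK⇒G4 d) (G4CK⇒G4 e)
G4CK⇒G4 (G4CK.◇⇒L ρ d e)  = ◇⇒L ρ (G4CK⇒G4 d) (G4CK⇒G4 e)
G4CK⇒G4 (G4CK.◇L ρ d)     = ◇L ρ (G4CK⇒G4 d) ◇-succedent

G4⇒G4CK : G4 CK Γ (just φ) → G4CK Γ φ
G4⇒G4CK (⊥L ρ)                = G4CK.⊥L ρ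
G4⇒G4CK (IdP ρ)               = G4CK.IdP ρ
G4⇒G4CK (∧L ρ d)              = G4CK.∧L ρ (G4⇒G4CK d)
G4⇒G4CK (∧R d e)              = G4CK.∧R (G4⇒G4CK d) (G4⇒G4CK e)
G4⇒G4CK (∨L ρ d e)            = G4CK.∨L ρ (G4⇒G4CK d) (G4⇒G4CK e)
G4⇒G4CK (∨R₁ d)               = G4CK.∨R₁ (G4⇒G4CK d)
G4⇒G4CK (∨R₂ d)               = G4CK.∨R₂ (G4⇒G4CK d)
G4⇒G4CK (⇒R d)                = G4CK.⇒R (G4⇒G4CK d)
G4⇒G4CK (∧⇒L ρ d)             = G4CK.∧⇒L ρ (G4⇒G4CK d)
G4⇒G4CK (∨⇒L ρ d)             = G4CK.∨⇒L ρ (G4⇒G4CK d)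
G4⇒G4CK (p⇒L ρ d)             = G4CK.p⇒L ρ (G4⇒G4CK d)
G4⇒G4CK (⇒⇒L ρ d e)           = G4CK.⇒⇒L ρ (G4⇒G4CK d) (G4⇒G4CK e)
G4⇒G4CK (□R d)                = G4CK.□R (G4⇒G4CK d)
G4⇒G4CK (□⇒L ρ d e)           = G4CK.□⇒L ρ (G4⇒G4CK d) (G4⇒G4CK e)
G4⇒G4CK (◇⇒L ρ d e)           = G4CK.◇⇒L ρ (G4⇒G4CK d) (G4⇒G4CK e)
G4⇒G4CK (◇L ρ d ◇-succedent) = G4CK.◇L ρ (G4⇒G4CK d)

G4WK⇒G4 : G4WK Γ Δ → G4 WK Γ Δ
G4WK⇒G4 (G4WK.⊥L ρ)       = ⊥L ρ
G4WK⇒G4 (G4WK.IdP ρ)      = IdP ρ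
G4WK⇒G4 (G4WK.∧L ρ d)     = ∧L ρ (G4WK⇒G4 d)
G4WK⇒G4 (G4WK.∧R d e)     = ∧R (G4WK⇒G4 d) (G4WK⇒G4 e)
G4WK⇒G4 (G4WK.∨L ρ d e)   = ∨L ρ (G4WK⇒G4 d) (G4WK⇒G4 e)
G4WK⇒G4 (G4WK.∨R₁ d)      = ∨R₁ (G4WK⇒G4 d)
G4WK⇒G4 (G4WK.∨R₂ d)      = ∨R₂ (G4WK⇒G4 d)
G4WK⇒G4 (G4WK.⇒R d)       = ⇒R (G4WK⇒G4 d)
G4WK⇒G4 (G4WK.∧⇒L ρ d)    = ∧⇒L ρ (G4WK⇒G4 d)
G4WK⇒G4 (G4WK.∨⇒L ρ d)    = ∨⇒L ρ (G4WK⇒G4 d)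
G4WK⇒G4 (G4WK.p⇒L ρ d)    = p⇒L ρ (G4WK⇒G4 d)
G4WK⇒G4 (G4WK.⇒⇒L ρ d e)  = ⇒⇒L ρ (G4WK⇒G4 d) (G4WK⇒G4 e)
G4WK⇒G4 (G4WK.□R d)       = □R (G4WK⇒G4 d)
G4WK⇒G4 (G4WK.□⇒L ρ d e)  = □⇒L ρ (G4WK⇒G4 d) (G4WK⇒G4 e)
G4WK⇒G4 (G4WK.◇⇒L ρ d e)  = ◇⇒L ρ (G4WK⇒G4 d) (G4WK⇒G4 e)
G4WK⇒G4 (G4WK.◇L' ρ d)    = ◇L ρ (G4WK⇒G4 d) WK-any

G4⇒G4WK : G4 WK Γ Δ → G4WK Γ Δ
G4⇒G4WK (⊥L ρ)       = G4WK.⊥L ρ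
G4⇒G4WK (IdP ρ)      = G4WK.IdP ρ
G4⇒G4WK (∧L ρ d)     = G4WK.∧L ρ (G4⇒G4WK d)
G4⇒G4WK (∧R d e)     = G4WK.∧R (G4⇒G4WK d) (G4⇒G4WK e)
G4⇒G4WK (∨L ρ d e)   = G4WK.∨L ρ (G4⇒G4WK d) (G4⇒G4WK e)
G4⇒G4WK (∨R₁ d)      = G4WK.∨R₁ (G4⇒G4WK d)
G4⇒G4WK (∨R₂ d)      = G4WK.∨R₂ (G4⇒G4WK d)
G4⇒G4WK (⇒R d)       = G4WK.⇒R (G4⇒G4WK d)
G4⇒G4WK (∧⇒L ρ d)    = G4WK.∧⇒L ρ (G4⇒G4WK d)
G4⇒G4WK (∨⇒L ρ d)    = G4WK.∨⇒L ρ (G4⇒G4WK d)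
G4⇒G4WK (p⇒L ρ d)    = G4WK.p⇒L ρ (G4⇒G4WK d)
G4⇒G4WK (⇒⇒L ρ d e)  = G4WK.⇒⇒L ρ (G4⇒G4WK d) (G4⇒G4WK e)
G4⇒G4WK (□R d)       = G4WK.□R (G4⇒G4WK d)
G4⇒G4WK (□⇒L ρ d e)  = G4WK.□⇒L ρ (G4⇒G4WK d) (G4⇒G4WK e)
G4⇒G4WK (◇⇒L ρ d e)  = G4WK.◇⇒L ρ (G4⇒G4WK d) (G4⇒G4WK e)
G4⇒G4WK (◇L ρ d _)   = G4WK.◇L' ρ (G4⇒G4WK d)

H : Logic → List Fm → Fm → Set
H L = Hilbert (Axiom L)

ck-ax : CKAx φ → H L Γ φ
ck-ax a = ax (CKAx⇒Axiom a)

H-mono : Γ ⊆ Γ' → H L Γ φ → H L Γ' φ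
H-mono Γ⊆Γ' (ax a)   = ax a
H-mono Γ⊆Γ' (hyp i)  = hyp (Γ⊆Γ' i)
H-mono Γ⊆Γ' (nec d)  = nec d
H-mono Γ⊆Γ' (mp d e) = mp (H-mono Γ⊆Γ' d) (H-mono Γ⊆Γ' e)

H-refl : H L Γ (φ ⇒ φ)
H-refl {φ = φ} = mp (ck-ax (K1 {φ} {φ})) (mp (ck-ax (K1 {φ} {φ ⇒ φ})) (ck-ax K2))

deduction : H L (φ ∷ Γ) ψ → H L Γ (φ ⇒ ψ)
deduction (ax a)         = mp (ax a) (ck-ax K1)
deduction (hyp ∈₀)       = H-refl
deduction (hyp (there i)) = mp (hyp i) (ck-ax K1)
deduction (nec d)        = mp (nec d) (ck-ax K1)
deduction (mp d e)       = mp (deduction d) (mp (deduction e) (ck-ax K2))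

H-cut : Γ ⊆ Γ' → H L (φ ∷ Γ) ψ → H L Γ' φ → H L Γ' ψ
H-cut Γ⊆Γ' d e = mp e (deduction (H-mono (∷⁺ʳ _ Γ⊆Γ') d))

H-cut₂ : Γ ⊆ Γ' → H L (φ ∷ ψ ∷ Γ) χ → H L Γ' φ → H L Γ' ψ → H L Γ' χ
H-cut₂ Γ⊆Γ' d e f = H-cut ⊆-refl (H-cut (∷⁺ʳ _ Γ⊆Γ') d (H-mono (⊆-∷ ⊆-refl) e)) f

∧-intro : H L Γ φ → H L Γ ψ → H L Γ (φ ∧ ψ)
∧-intro d e = mp d (mp (mp e (ck-ax K1)) (mp H-refl (ck-ax C3)))

efq : H L Γ ⊥' → H L Γ φ
efq d = mp d (ck-ax EFQ)

□-intro-⊆ : ∀ Θ → (∀ {φ} → φ ∈ Θ → □ φ ∈ Γ) → H L Θ ψ → H L Γ (□ ψ)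
□-intro-⊆ []      Θ⊆□Γ d = nec d
□-intro-⊆ (_ ∷ Θ) Θ⊆□Γ d =
  mp (hyp (Θ⊆□Γ ∈₀)) (mp (□-intro-⊆ Θ (λ i → Θ⊆□Γ (there i)) (deduction d)) (ck-ax K□))

□-intro : H L (box⁻¹ Γ) φ → H L Γ (□ φ)
□-intro = □-intro-⊆ _ ∈box⁻¹⇒□∈

◇-intro : ◇ γ ∈ Γ → H L (γ ∷ box⁻¹ Γ) φ → H L Γ (◇ φ)
◇-intro i d = mp (hyp i) (mp (□-intro (deduction d)) (ck-ax K◇))

-- Soundness of G4

◇L-sound : ∀ Δ → ◇L-Allowed L Δ → ◇ φ ∈ Γ
         → H L (φ ∷ box⁻¹ Γ) (succ-fm (dia⁻¹ Δ)) → H L Γ (succ-fm Δ)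
◇L-sound _               ◇-succedent i d = ◇-intro i d
◇L-sound (just (◇ _))    WK-any      i d = ◇-intro i d
◇L-sound nothing         WK-any      i d = mp (◇-intro i d) (ax N◇)
◇L-sound (just (var _))  WK-any      i d = efq (mp (◇-intro i d) (ax N◇))
◇L-sound (just ⊥')       WK-any      i d = efq (mp (◇-intro i d) (ax N◇))
◇L-sound (just (_ ∧ _))  WK-any      i d = efq (mp (◇-intro i d) (ax N◇))
◇L-sound (just (_ ∨ _))  WK-any      i d = efq (mp (◇-intro i d) (ax N◇))
◇L-sound (just (_ ⇒ _))  WK-any      i d = efq (mp (◇-intro i d) (ax N◇))
◇L-sound (just (□ _))    WK-any      i d = efq (mp (◇-intro i d) (ax N◇))

G4⇒H : G4 L Γ Δ → H L Γ (succ-fm Δ)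
G4⇒H (⊥L ρ)       = efq (hyp (↭∷⇒∈ ρ))
G4⇒H (IdP ρ)      = hyp (↭∷⇒∈ ρ)
G4⇒H (∧L ρ d)     = H-cut₂ (↭∷⇒⊆ ρ) (G4⇒H d) (mp φ∧ψ (ck-ax C1)) (mp φ∧ψ (ck-ax C2))
  where φ∧ψ = hyp (↭∷⇒∈ ρ)
G4⇒H (∧R d e)     = ∧-intro (G4⇒H d) (G4⇒H e)
G4⇒H (∨L ρ d e)   =
  mp (hyp (↭∷⇒∈ ρ)) (mp (deduction (H-mono (∷⁺ʳ _ (↭∷⇒⊆ ρ)) (G4⇒H e)))
                        (mp (deduction (H-mono (∷⁺ʳ _ (↭∷⇒⊆ ρ)) (G4⇒H d))) (ck-ax D3)))
G4⇒H (∨R₁ d)      = mp (G4⇒H d) (ck-ax D1)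
G4⇒H (∨R₂ d)      = mp (G4⇒H d) (ck-ax D2)
G4⇒H (⇒R d)       = deduction (G4⇒H d)
G4⇒H (∧⇒L ρ d)    = H-cut (↭∷⇒⊆ ρ) (G4⇒H d) (deduction (deduction φ∧ψ⇒χ))
  where φ∧ψ⇒χ = mp (∧-intro (hyp ∈₁) (hyp ∈₀)) (hyp (there (there (↭∷⇒∈ ρ))))
G4⇒H (∨⇒L ρ d)    = H-cut₂ (↭∷⇒⊆ ρ) (G4⇒H d)
  (deduction (mp (mp (hyp ∈₀) (ck-ax D1)) (hyp (there (↭∷⇒∈ ρ)))))
  (deduction (mp (mp (hyp ∈₀) (ck-ax D2)) (hyp (there (↭∷⇒∈ ρ)))))
G4⇒H (p⇒L ρ d)    =
  H-cut (↭∷∷⇒⊆ ρ) (H-mono ∷-swap-⊆ (G4⇒H d)) (mp (hyp (↭∷⇒∈ ρ)) (hyp (↭∷⇒⊆ ρ ∈₀)))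
G4⇒H (⇒⇒L ρ d e)  = H-cut (↭∷⇒⊆ ρ) (G4⇒H e) (mp (H-cut (↭∷⇒⊆ ρ) (G4⇒H d) ψ⇒χ) (hyp (↭∷⇒∈ ρ)))
  where ψ⇒χ = deduction (mp (mp (hyp ∈₀) (ck-ax K1)) (hyp (there (↭∷⇒∈ ρ))))
G4⇒H (□R d)       = □-intro (G4⇒H d)
G4⇒H (□⇒L ρ d e)  =
  H-cut (↭∷⇒⊆ ρ) (G4⇒H e) (mp (H-mono (↭∷⇒⊆ ρ) (□-intro (G4⇒H d))) (hyp (↭∷⇒∈ ρ)))
G4⇒H (◇⇒L ρ d e)  = H-cut (↭∷∷⇒⊆ ρ) (H-mono ∷-swap-⊆ (G4⇒H e)) (mp ◇φ (hyp (↭∷⇒⊆ ρ ∈₀)))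
  where ◇φ = ◇-intro (↭∷⇒∈ ρ) (H-mono (∷⁺ʳ _ (box⁻¹-mono (↭∷⇒⊆ ρ))) (G4⇒H d))
G4⇒H (◇L {Δ = Δ} ρ d allowed) =
  ◇L-sound Δ allowed (↭∷⇒∈ ρ) (H-mono (∷⁺ʳ _ (box⁻¹-mono (↭∷⇒⊆ ρ))) (G4⇒H d))

-- A Kleene-style calculus G3: principal formulas are kept, so contexts behave as sets

data G3 (L : Logic) : List Fm → Maybe Fm → Set where
  ⊥L  : ⊥' ∈ Γ → G3 L Γ Δ
  Id  : var p ∈ Γ → G3 L Γ (just (var p))
  ∧L  : φ ∧ ψ ∈ Γ → G3 L (φ ∷ ψ ∷ Γ) Δ → G3 L Γ Δ
  ∧R  : G3 L Γ (just φ) → G3 L Γ (just ψ) → G3 L Γ (just (φ ∧ ψ))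
  ∨L  : φ ∨ ψ ∈ Γ → G3 L (φ ∷ Γ) Δ → G3 L (ψ ∷ Γ) Δ → G3 L Γ Δ
  ∨R₁ : G3 L Γ (just φ) → G3 L Γ (just (φ ∨ ψ))
  ∨R₂ : G3 L Γ (just ψ) → G3 L Γ (just (φ ∨ ψ))
  ⇒L  : φ ⇒ ψ ∈ Γ → G3 L Γ (just φ) → G3 L (ψ ∷ Γ) Δ → G3 L Γ Δ
  ⇒R  : G3 L (φ ∷ Γ) (just ψ) → G3 L Γ (just (φ ⇒ ψ))
  □R  : G3 L (box⁻¹ Γ) (just φ) → G3 L Γ (just (□ φ))
  ◇L  : ◇ φ ∈ Γ → G3 L (φ ∷ box⁻¹ Γ) (dia⁻¹ Δ) → ◇L-Allowed L Δ → G3 L Γ Δ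

G3-mono : Γ ⊆ Γ' → G3 L Γ Δ → G3 L Γ' Δ
G3-mono s (⊥L i)       = ⊥L (s i)
G3-mono s (Id i)       = Id (s i)
G3-mono s (∧L i d)     = ∧L (s i) (G3-mono (∷⁺ʳ _ (∷⁺ʳ _ s)) d)
G3-mono s (∧R d e)     = ∧R (G3-mono s d) (G3-mono s e)
G3-mono s (∨L i d e)   = ∨L (s i) (G3-mono (∷⁺ʳ _ s) d) (G3-mono (∷⁺ʳ _ s) e)
G3-mono s (∨R₁ d)      = ∨R₁ (G3-mono s d)
G3-mono s (∨R₂ d)      = ∨R₂ (G3-mono s d)
G3-mono s (⇒L i d e)   = ⇒L (s i) (G3-mono s d) (G3-mono (∷⁺ʳ _ s) e)
G3-mono s (⇒R d)       = ⇒R (G3-mono (∷⁺ʳ _ s) d)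
G3-mono s (□R d)       = □R (G3-mono (box⁻¹-mono s) d)
G3-mono s (◇L i d ok)  = ◇L (s i) (G3-mono (∷⁺ʳ _ (box⁻¹-mono s)) d) ok

G3-weakenʳ : G3 WK Γ nothing → G3 WK Γ Δ
G3-weakenʳ (⊥L i)      = ⊥L i
G3-weakenʳ (∧L i d)    = ∧L i (G3-weakenʳ d)
G3-weakenʳ (∨L i d e)  = ∨L i (G3-weakenʳ d) (G3-weakenʳ e)
G3-weakenʳ (⇒L i d e)  = ⇒L i d (G3-weakenʳ e)
G3-weakenʳ (◇L i d _)  = ◇L i (G3-weakenʳ d) WK-any

G3-id : φ ∈ Γ → G3 L Γ (just φ)
G3-id {φ = var _} i = Id i
G3-id {φ = ⊥'}    i = ⊥L i
G3-id {φ = _ ∧ _} i = ∧L i (∧R (G3-id ∈₀) (G3-id ∈₁))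
G3-id {φ = _ ∨ _} i = ∨L i (∨R₁ (G3-id ∈₀)) (∨R₂ (G3-id ∈₀))
G3-id {φ = _ ⇒ _} i = ⇒R (⇒L (there i) (G3-id ∈₀) (G3-id ∈₀))
G3-id {φ = □ _}   i = □R (G3-id (□∈⇒∈box⁻¹ i))
G3-id {φ = ◇ _}   i = ◇L i (G3-id ∈₀) ◇-succedent

-- Cut admissibility in G3

-- ◇L with succedent ◇φ counts as a right rule here.
data RightRule (L : Logic) (Γ : List Fm) : Fm → Set where
  Id  : var p ∈ Γ → RightRule L Γ (var p)
  ∧R  : G3 L Γ (just φ) → G3 L Γ (just ψ) → RightRule L Γ (φ ∧ ψ)
  ∨R₁ : G3 L Γ (just φ) → RightRule L Γ (φ ∨ ψ)
  ∨R₂ : G3 L Γ (just ψ) → RightRule L Γ (φ ∨ ψ)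
  ⇒R  : G3 L (φ ∷ Γ) (just ψ) → RightRule L Γ (φ ⇒ ψ)
  □R  : G3 L (box⁻¹ Γ) (just φ) → RightRule L Γ (□ φ)
  ◇R  : ◇ γ ∈ Γ → G3 L (γ ∷ box⁻¹ Γ) (just φ) → RightRule L Γ (◇ φ)

-- In WK, a left premise ending in ◇L may prove the empty succedent; then no cut is needed.
◇L-empty : ◇ γ ∈ Γ₁ → G3 WK (γ ∷ box⁻¹ Γ₁) nothing → Γ₁ ⊆ Γ → G3 WK Γ Δ
◇L-empty i d s = ◇L (s i) (G3-weakenʳ (G3-mono (∷⁺ʳ _ (box⁻¹-mono s)) d)) WK-any

-- Induction on the cut formula, then on the left premise (cut), then on the right one (cutʳ);
-- the contexts are related by ⊆ so that the recursion needs no weakening of derivations.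
mutual
  cut : ∀ φ → G3 L Γ₁ (just φ) → G3 L Γ₂ Δ → Γ₁ ⊆ Γ → Γ₂ ⊆ φ ∷ Γ → G3 L Γ Δ
  cut φ (⊥L i)       e s₁ s₂ = ⊥L (s₁ i)
  cut φ (Id i)       e s₁ s₂ = cutʳ φ (Id i) e s₁ s₂
  cut φ (∧L i d)     e s₁ s₂ = ∧L (s₁ i) (cut φ d e (∷⁺ʳ _ (∷⁺ʳ _ s₁)) (⊆-∷₂ (⊆-∷₂ s₂)))
  cut φ (∧R d d')    e s₁ s₂ = cutʳ φ (∧R d d') e s₁ s₂
  cut φ (∨L i d d')  e s₁ s₂ =
    ∨L (s₁ i) (cut φ d e (∷⁺ʳ _ s₁) (⊆-∷₂ s₂))
              (cut φ d' e (∷⁺ʳ _ s₁) (⊆-∷₂ s₂))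
  cut φ (∨R₁ d)      e s₁ s₂ = cutʳ φ (∨R₁ d) e s₁ s₂
  cut φ (∨R₂ d)      e s₁ s₂ = cutʳ φ (∨R₂ d) e s₁ s₂
  cut φ (⇒L i d d')  e s₁ s₂ = ⇒L (s₁ i) (G3-mono s₁ d) (cut φ d' e (∷⁺ʳ _ s₁) (⊆-∷₂ s₂))
  cut φ (⇒R d)       e s₁ s₂ = cutʳ φ (⇒R d) e s₁ s₂
  cut φ (□R d)       e s₁ s₂ = cutʳ φ (□R d) e s₁ s₂
  cut (◇ φ) (◇L i d _)      e s₁ s₂ = cutʳ (◇ φ) (◇R i d) e s₁ s₂
  cut (var _) (◇L i d WK-any) e s₁ s₂ = ◇L-empty i d s₁
  cut ⊥'      (◇L i d WK-any) e s₁ s₂ = ◇L-empty i d s₁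
  cut (_ ∧ _) (◇L i d WK-any) e s₁ s₂ = ◇L-empty i d s₁
  cut (_ ∨ _) (◇L i d WK-any) e s₁ s₂ = ◇L-empty i d s₁
  cut (_ ⇒ _) (◇L i d WK-any) e s₁ s₂ = ◇L-empty i d s₁
  cut (□ _)   (◇L i d WK-any) e s₁ s₂ = ◇L-empty i d s₁

  cutʳ : ∀ φ → RightRule L Γ₁ φ → G3 L Γ₂ Δ → Γ₁ ⊆ Γ → Γ₂ ⊆ φ ∷ Γ → G3 L Γ Δ
  cutʳ φ r (⊥L i) s₁ s₂ with s₂ i | r
  ... | here refl | ()
  ... | there i'  | _ = ⊥L i'
  cutʳ φ r (Id i) s₁ s₂ with s₂ i | r
  ... | here refl | Id j = Id (s₁ j)
  ... | there i'  | _    = Id i'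
  cutʳ φ r (∧L i e) s₁ s₂ with s₂ i | r | cutʳ φ r e (⊆-∷ (⊆-∷ s₁)) (⊆-∷-under (⊆-∷-under s₂))
  ... | here refl | ∧R d d' | e' = cut _ d (cut _ d' e' (⊆-∷ s₁) ∷-swap-⊆) s₁ ⊆-refl
  ... | there i'  | _       | e' = ∧L i' e'
  cutʳ φ r (∧R e e') s₁ s₂ = ∧R (cutʳ φ r e s₁ s₂) (cutʳ φ r e' s₁ s₂)
  cutʳ φ r (∨L i e e') s₁ s₂
    with s₂ i | r | cutʳ φ r e (⊆-∷ s₁) (⊆-∷-under s₂) | cutʳ φ r e' (⊆-∷ s₁) (⊆-∷-under s₂)
  ... | here refl | ∨R₁ d | f | _  = cut _ d f s₁ ⊆-refl
  ... | here refl | ∨R₂ d | _ | f' = cut _ d f' s₁ ⊆-refl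
  ... | there i'  | _     | f | f' = ∨L i' f f'
  cutʳ φ r (∨R₁ e) s₁ s₂ = ∨R₁ (cutʳ φ r e s₁ s₂)
  cutʳ φ r (∨R₂ e) s₁ s₂ = ∨R₂ (cutʳ φ r e s₁ s₂)
  cutʳ φ r (⇒L i e e') s₁ s₂
    with s₂ i | r | cutʳ φ r e s₁ s₂ | cutʳ φ r e' (⊆-∷ s₁) (⊆-∷-under s₂)
  ... | here refl | ⇒R d | f | f' = cut _ (cut _ f d ⊆-refl (∷⁺ʳ _ s₁)) f' ⊆-refl ⊆-refl
  ... | there i'  | _    | f | f' = ⇒L i' f f'
  cutʳ φ r (⇒R e) s₁ s₂ = ⇒R (cutʳ φ r e (⊆-∷ s₁) (⊆-∷-under s₂))
  cutʳ φ r (□R e) s₁ s₂ = □R (cut-box⁻¹ φ [] r s₁ e (box⁻¹-mono s₂))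
  cutʳ φ r (◇L i e ok) s₁ s₂ with s₂ i | r
  ... | here refl | ◇R j d =
    ◇L (s₁ j) (cut _ d e (∷⁺ʳ _ (box⁻¹-mono s₁)) (⊆-∷₂ (∷⁺ʳ _ (box⁻¹-mono s₂)))) ok
  ... | there i'  | _      = ◇L i' (cut-box⁻¹ φ (_ ∷ []) r s₁ e (∷⁺ʳ _ (box⁻¹-mono s₂))) ok

  -- Cutting φ inside box⁻¹: only a boxed φ is visible there, and then its □R premise is cut.
  cut-box⁻¹ : ∀ φ Θ → RightRule L Γ₁ φ → Γ₁ ⊆ Γ
            → G3 L Ξ Δ → Ξ ⊆ Θ ++ box⁻¹ (φ ∷ Γ) → G3 L (Θ ++ box⁻¹ Γ) Δ
  cut-box⁻¹ (□ φ)   Θ (□R d) s₁ e s₂ =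
    cut φ d e (⊆-trans (box⁻¹-mono s₁) (xs⊆ys++xs _ Θ)) (⊆-trans s₂ (++-shift-⊆ Θ))
  cut-box⁻¹ (var _) Θ r s₁ e s₂ = G3-mono s₂ e
  cut-box⁻¹ ⊥'      Θ r s₁ e s₂ = G3-mono s₂ e
  cut-box⁻¹ (_ ∧ _) Θ r s₁ e s₂ = G3-mono s₂ e
  cut-box⁻¹ (_ ∨ _) Θ r s₁ e s₂ = G3-mono s₂ e
  cut-box⁻¹ (_ ⇒ _) Θ r s₁ e s₂ = G3-mono s₂ e
  cut-box⁻¹ (◇ _)   Θ r s₁ e s₂ = G3-mono s₂ e

G3-cut : G3 L Γ (just φ) → G3 L (φ ∷ Γ) Δ → G3 L Γ Δ
G3-cut {φ = φ} d e = cut φ d e ⊆-refl ⊆-refl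

G3-replace : G3 L Γ Δ → Γ ⊆ φ ∷ Γ' → G3 L Γ' (just φ) → G3 L Γ' Δ
G3-replace {φ = φ} e s d = cut φ d e ⊆-refl s

⇒R-inv : G3 L Γ (just (φ ⇒ ψ)) → G3 L (φ ∷ Γ) (just ψ)
⇒R-inv d = G3-cut (G3-mono (⊆-∷ ⊆-refl) d) (⇒L ∈₀ (G3-id ∈₁) (G3-id ∈₀))

CKAx⇒G3 : CKAx φ → G3 L [] (just φ)
CKAx⇒G3 K1  = ⇒R (⇒R (G3-id ∈₁))
CKAx⇒G3 K2  = ⇒R (⇒R (⇒R (⇒L ∈₂ (G3-id ∈₀) (⇒L ∈₀ (⇒L ∈₂ (G3-id ∈₁) (G3-id ∈₀)) (G3-id ∈₀)))))
CKAx⇒G3 D1  = ⇒R (∨R₁ (G3-id ∈₀))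
CKAx⇒G3 D2  = ⇒R (∨R₂ (G3-id ∈₀))
CKAx⇒G3 D3  = ⇒R (⇒R (⇒R (∨L ∈₀ (⇒L ∈₃ (G3-id ∈₀) (G3-id ∈₀)) (⇒L ∈₂ (G3-id ∈₀) (G3-id ∈₀)))))
CKAx⇒G3 C1  = ⇒R (∧L ∈₀ (G3-id ∈₀))
CKAx⇒G3 C2  = ⇒R (∧L ∈₀ (G3-id ∈₁))
CKAx⇒G3 C3  = ⇒R (⇒R (⇒R (∧R (⇒L ∈₂ (G3-id ∈₀) (G3-id ∈₀)) (⇒L ∈₁ (G3-id ∈₀) (G3-id ∈₀)))))
CKAx⇒G3 EFQ = ⇒R (⊥L ∈₀)
CKAx⇒G3 K□  = ⇒R (⇒R (□R (⇒L ∈₁ (G3-id ∈₀) (G3-id ∈₀))))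
CKAx⇒G3 K◇  = ⇒R (⇒R (◇L ∈₀ (⇒L ∈₁ (G3-id ∈₀) (G3-id ∈₀)) ◇-succedent))

Axiom⇒G3 : Axiom L φ → G3 L [] (just φ)
Axiom⇒G3 {L = CK} a      = CKAx⇒G3 a
Axiom⇒G3 {L = WK} (ck a) = CKAx⇒G3 a
Axiom⇒G3 {L = WK} N◇     = ⇒R (◇L ∈₀ (⊥L ∈₀) WK-any)

H⇒G3 : H L Γ φ → G3 L Γ (just φ)
H⇒G3 (ax a)   = G3-mono (λ ()) (Axiom⇒G3 a)
H⇒G3 (hyp i)  = G3-id i
H⇒G3 (nec d)  = □R (G3-mono (λ ()) (H⇒G3 d))
H⇒G3 (mp d e) = G3-cut (H⇒G3 e) (⇒L ∈₀ (G3-mono (⊆-∷ ⊆-refl) (H⇒G3 d)) (G3-id ∈₀))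

H⇒G3-succ : ∀ Δ → H L Γ (succ-fm Δ) → G3 L Γ Δ
H⇒G3-succ (just φ) d = H⇒G3 d
H⇒G3-succ nothing  d = G3-cut (H⇒G3 d) (⊥L ∈₀)

-- A termination measure for G4

-- Dyckhoff's weight, with ∧ counting twice so that (φ ∧ ψ) ⇒ χ outweighs φ ⇒ (ψ ⇒ χ).
rank : Fm → ℕ
rank (var _) = 0
rank ⊥'      = 0
rank (φ ∧ ψ) = 2 + (rank φ + rank ψ)
rank (φ ∨ ψ) = 1 + (rank φ + rank ψ)
rank (φ ⇒ ψ) = 1 + (rank φ + rank ψ)
rank (□ φ)   = 1 + rank φ
rank (◇ φ)   = 1 + rank φ

-- A data type rather than rank φ < rank ψ, so that φ and ψ can be inferred.
infix 4 _≺_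
data _≺_ (φ ψ : Fm) : Set where
  rank-< : rank φ < rank ψ → φ ≺ ψ

≺-trans : φ ≺ ψ → ψ ≺ χ → φ ≺ χ
≺-trans (rank-< lt) (rank-< lt') = rank-< (<-trans lt lt')

≺-∧ˡ : φ ≺ φ ∧ ψ
≺-∧ˡ = rank-< (m<n⇒m<1+n (s≤s (m≤m+n _ _)))

≺-∧ʳ : ψ ≺ φ ∧ ψ
≺-∧ʳ = rank-< (m<n⇒m<1+n (s≤s (m≤n+m _ _)))

≺-∨ˡ : φ ≺ φ ∨ ψ
≺-∨ˡ = rank-< (s≤s (m≤m+n _ _))

≺-∨ʳ : ψ ≺ φ ∨ ψ
≺-∨ʳ = rank-< (s≤s (m≤n+m _ _))

≺-⇒ˡ : φ ≺ φ ⇒ ψ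
≺-⇒ˡ = rank-< (s≤s (m≤m+n _ _))

≺-⇒ʳ : ψ ≺ φ ⇒ ψ
≺-⇒ʳ = rank-< (s≤s (m≤n+m _ _))

≺-□ : φ ≺ □ φ
≺-□ = rank-< ≤-refl

≺-◇ : φ ≺ ◇ φ
≺-◇ = rank-< ≤-refl

≺-∧⇒ : φ ⇒ (ψ ⇒ χ) ≺ (φ ∧ ψ) ⇒ χ
≺-∧⇒ {φ} {ψ} {χ} =
  rank-< (s≤s (s≤s (≤-reflexive (trans (+-suc (rank φ) _) (cong suc (sym (+-assoc (rank φ) (rank ψ) (rank χ))))))))

≺-∨⇒ˡ : φ ⇒ χ ≺ (φ ∨ ψ) ⇒ χ
≺-∨⇒ˡ {φ} {χ} {ψ} = rank-< (s≤s (s≤s (+-monoˡ-≤ (rank χ) (m≤m+n (rank φ) (rank ψ)))))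

≺-∨⇒ʳ : ψ ⇒ χ ≺ (φ ∨ ψ) ⇒ χ
≺-∨⇒ʳ {ψ} {χ} {φ} = rank-< (s≤s (s≤s (+-monoˡ-≤ (rank χ) (m≤n+m (rank ψ) (rank φ)))))

≺-⇒⇒ : ψ ⇒ χ ≺ (φ ⇒ ψ) ⇒ χ
≺-⇒⇒ {ψ} {χ} {φ} = rank-< (s≤s (s≤s (+-monoˡ-≤ (rank χ) (m≤n+m (rank ψ) (rank φ)))))

-- Exponentiating the rank makes the sum over a sequent a multiset ordering:
-- trading a formula for two formulas of smaller rank decreases it.
weight : Fm → ℕ
weight φ = 3 ^ rank φ

‖_‖ : List Fm → ℕ
‖ Γ ‖ = sum (map weight Γ)

μ : List Fm → Maybe Fm → ℕ
μ Γ Δ = ‖ Γ ++ fromMaybe Δ ‖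

3^+3^<3^ : ∀ {l m n} → l < n → m < n → 3 ^ l + 3 ^ m < 3 ^ n
3^+3^<3^ {l} {m} {suc n} (s≤s l≤n) (s≤s m≤n) = begin-strict
  3 ^ l + 3 ^ m                 ≤⟨ +-mono-≤ (^-monoʳ-≤ 3 l≤n) (^-monoʳ-≤ 3 m≤n) ⟩
  3 ^ n + 3 ^ n                 <⟨ +-monoʳ-< (3 ^ n) (m<m+n (3 ^ n) (≤-trans (m^n>0 3 n) (m≤m+n _ 0))) ⟩
  3 ^ n + (3 ^ n + (3 ^ n + 0)) ∎
  where open ≤-Reasoning

weight-+-< : φ ≺ χ → ψ ≺ χ → weight φ + weight ψ < weight χ
weight-+-< (rank-< lt) (rank-< lt') = 3^+3^<3^ lt lt'

weight-< : φ ≺ ψ → weight φ < weight ψ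
weight-< {φ} φ≺ψ = ≤-<-trans (m≤m+n (weight φ) (weight φ)) (weight-+-< φ≺ψ φ≺ψ)

‖‖-↭ : Γ ↭ Γ' → ‖ Γ ‖ ≡ ‖ Γ' ‖
‖‖-↭ ρ = sum-↭ (↭-map⁺ weight ρ)

‖‖-++ : ∀ Γ Γ' → ‖ Γ ++ Γ' ‖ ≡ ‖ Γ ‖ + ‖ Γ' ‖
‖‖-++ Γ Γ' = trans (cong sum (map-++ weight Γ Γ')) (sum-++ (map weight Γ) (map weight Γ'))

‖box⁻¹‖≤ : ∀ Γ → ‖ box⁻¹ Γ ‖ ≤ ‖ Γ ‖
‖box⁻¹‖≤ []          = z≤n
‖box⁻¹‖≤ (□ φ ∷ Γ)   = +-mono-≤ (<⇒≤ (weight-< (≺-□ {φ}))) (‖box⁻¹‖≤ Γ)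
‖box⁻¹‖≤ (var _ ∷ Γ) = m≤n⇒m≤o+n _ (‖box⁻¹‖≤ Γ)
‖box⁻¹‖≤ (⊥' ∷ Γ)    = m≤n⇒m≤o+n _ (‖box⁻¹‖≤ Γ)
‖box⁻¹‖≤ (_ ∧ _ ∷ Γ) = m≤n⇒m≤o+n _ (‖box⁻¹‖≤ Γ)
‖box⁻¹‖≤ (_ ∨ _ ∷ Γ) = m≤n⇒m≤o+n _ (‖box⁻¹‖≤ Γ)
‖box⁻¹‖≤ (_ ⇒ _ ∷ Γ) = m≤n⇒m≤o+n _ (‖box⁻¹‖≤ Γ)
‖box⁻¹‖≤ (◇ _ ∷ Γ)   = m≤n⇒m≤o+n _ (‖box⁻¹‖≤ Γ)

‖dia⁻¹‖≤ : ∀ Δ → ‖ fromMaybe (dia⁻¹ Δ) ‖ ≤ ‖ fromMaybe Δ ‖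
‖dia⁻¹‖≤ nothing        = z≤n
‖dia⁻¹‖≤ (just (◇ φ))   = +-monoˡ-≤ 0 (<⇒≤ (weight-< (≺-◇ {φ})))
‖dia⁻¹‖≤ (just (var _)) = z≤n
‖dia⁻¹‖≤ (just ⊥')      = z≤n
‖dia⁻¹‖≤ (just (_ ∧ _)) = z≤n
‖dia⁻¹‖≤ (just (_ ∨ _)) = z≤n
‖dia⁻¹‖≤ (just (_ ⇒ _)) = z≤n
‖dia⁻¹‖≤ (just (□ _))   = z≤n

μ-just : ∀ Γ φ → μ Γ (just φ) ≡ ‖ Γ ‖ + weight φ
μ-just Γ φ = trans (‖‖-++ Γ (φ ∷ [])) (cong (‖ Γ ‖ +_) (+-identityʳ (weight φ)))

‖‖≤μ : ∀ Γ Δ → ‖ Γ ‖ ≤ μ Γ Δ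
‖‖≤μ Γ Δ = subst (‖ Γ ‖ ≤_) (sym (‖‖-++ Γ (fromMaybe Δ))) (m≤m+n _ _)

μ-mono : ∀ Γ' Γ Δ' Δ → ‖ Γ' ‖ ≤ ‖ Γ ‖ → ‖ fromMaybe Δ' ‖ ≤ ‖ fromMaybe Δ ‖ → μ Γ' Δ' ≤ μ Γ Δ
μ-mono Γ' Γ Δ' Δ le le' =
  subst₂ _≤_ (sym (‖‖-++ Γ' (fromMaybe Δ'))) (sym (‖‖-++ Γ (fromMaybe Δ))) (+-mono-≤ le le')

μ-<-↭ : ∀ {n} → Γ ↭ Γ₁ → n < μ Γ₁ Δ → n < μ Γ Δ
μ-<-↭ {Γ₁ = Γ₁} {Δ} {n} ρ = subst (n <_) (sym (‖‖-↭ (++⁺ʳ (fromMaybe Δ) ρ)))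

μ-<-replace₁ : Γ ↭ χ ∷ Γ₀ → φ ≺ χ → μ (φ ∷ Γ₀) Δ < μ Γ Δ
μ-<-replace₁ {Γ₀ = Γ₀} {Δ = Δ} ρ φ≺χ = μ-<-↭ ρ (+-monoˡ-< (μ Γ₀ Δ) (weight-< φ≺χ))

μ-<-replace₂ : Γ ↭ χ ∷ Γ₀ → φ ≺ χ → ψ ≺ χ → μ (φ ∷ ψ ∷ Γ₀) Δ < μ Γ Δ
μ-<-replace₂ {χ = χ} {Γ₀} {φ} {ψ} {Δ} ρ φ≺χ ψ≺χ = μ-<-↭ ρ
  (subst (_< weight χ + μ Γ₀ Δ) (+-assoc (weight φ) (weight ψ) (μ Γ₀ Δ))
         (+-monoˡ-< (μ Γ₀ Δ) (weight-+-< φ≺χ ψ≺χ)))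

μ-<-replace-2nd : Γ ↭ θ ∷ χ ∷ Γ₀ → φ ≺ χ → μ (θ ∷ φ ∷ Γ₀) Δ < μ Γ Δ
μ-<-replace-2nd {θ = θ} {Γ₀ = Γ₀} {Δ = Δ} ρ φ≺χ =
  μ-<-↭ ρ (+-monoʳ-< (weight θ) (+-monoˡ-< (μ Γ₀ Δ) (weight-< φ≺χ)))

μ-<-replace-succ : Γ ↭ χ ∷ Γ₀ → φ ≺ χ → ψ ≺ χ → μ (φ ∷ Γ₀) (just ψ) < μ Γ Δ
μ-<-replace-succ {χ = χ} {Γ₀} {φ} {ψ} {Δ} ρ φ≺χ ψ≺χ = μ-<-↭ ρ (begin-strict
  weight φ + μ Γ₀ (just ψ)       ≡⟨ cong (weight φ +_) (trans (μ-just Γ₀ ψ) (+-comm ‖ Γ₀ ‖ (weight ψ))) ⟩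
  weight φ + (weight ψ + ‖ Γ₀ ‖) ≡⟨ +-assoc (weight φ) (weight ψ) ‖ Γ₀ ‖ ⟨
  weight φ + weight ψ + ‖ Γ₀ ‖   <⟨ +-monoˡ-< ‖ Γ₀ ‖ (weight-+-< φ≺χ ψ≺χ) ⟩
  weight χ + ‖ Γ₀ ‖              ≤⟨ +-monoʳ-≤ (weight χ) (‖‖≤μ Γ₀ Δ) ⟩
  weight χ + μ Γ₀ Δ              ∎)
  where open ≤-Reasoning

μ-<-box⁻¹ : ∀ Γ → φ ≺ χ → μ (box⁻¹ Γ) (just φ) < μ (χ ∷ Γ) Δ
μ-<-box⁻¹ {φ} {χ} {Δ} Γ φ≺χ = begin-strict
  μ (box⁻¹ Γ) (just φ)   ≡⟨ μ-just (box⁻¹ Γ) φ ⟩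
  ‖ box⁻¹ Γ ‖ + weight φ <⟨ +-mono-≤-< (‖box⁻¹‖≤ Γ) (weight-< φ≺χ) ⟩
  ‖ Γ ‖ + weight χ       ≡⟨ +-comm ‖ Γ ‖ (weight χ) ⟩
  weight χ + ‖ Γ ‖       ≤⟨ +-monoʳ-≤ (weight χ) (‖‖≤μ Γ Δ) ⟩
  weight χ + μ Γ Δ       ∎
  where open ≤-Reasoning

μ-<-□⇒L : Γ ↭ χ ∷ Γ₀ → φ ≺ χ → μ (box⁻¹ Γ₀) (just φ) < μ Γ Δ
μ-<-□⇒L {Γ₀ = Γ₀} ρ φ≺χ = μ-<-↭ ρ (μ-<-box⁻¹ Γ₀ φ≺χ)

μ-<-◇⇒L : Γ ↭ ◇ γ ∷ χ ∷ Γ₀ → φ ≺ χ → μ (γ ∷ box⁻¹ Γ₀) (just φ) < μ Γ Δ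
μ-<-◇⇒L {γ = γ} {Γ₀ = Γ₀} ρ φ≺χ = μ-<-↭ ρ (+-mono-< (weight-< (≺-◇ {γ})) (μ-<-box⁻¹ Γ₀ φ≺χ))

μ-<-◇L : Γ ↭ ◇ φ ∷ Γ₀ → μ (φ ∷ box⁻¹ Γ₀) (dia⁻¹ Δ) < μ Γ Δ
μ-<-◇L {φ = φ} {Γ₀ = Γ₀} {Δ = Δ} ρ = μ-<-↭ ρ
  (+-mono-<-≤ (weight-< (≺-◇ {φ})) (μ-mono (box⁻¹ Γ₀) Γ₀ (dia⁻¹ Δ) Δ (‖box⁻¹‖≤ Γ₀) (‖dia⁻¹‖≤ Δ)))

μ-<-just : ∀ Γ' Γ → ‖ Γ' ‖ ≤ ‖ Γ ‖ → φ ≺ ψ → μ Γ' (just φ) < μ Γ (just ψ)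
μ-<-just {φ} {ψ} Γ' Γ le φ≺ψ =
  subst₂ _<_ (sym (μ-just Γ' φ)) (sym (μ-just Γ ψ)) (+-mono-≤-< le (weight-< φ≺ψ))

μ-<-⇒R : ∀ Γ → μ (φ ∷ Γ) (just ψ) < μ Γ (just (φ ⇒ ψ))
μ-<-⇒R {φ} {ψ} Γ = begin-strict
  weight φ + μ Γ (just ψ)       ≡⟨ cong (weight φ +_) (μ-just Γ ψ) ⟩
  weight φ + (‖ Γ ‖ + weight ψ) ≡⟨ +-assoc (weight φ) ‖ Γ ‖ (weight ψ) ⟨
  weight φ + ‖ Γ ‖ + weight ψ   ≡⟨ cong (_+ weight ψ) (+-comm (weight φ) ‖ Γ ‖) ⟩
  ‖ Γ ‖ + weight φ + weight ψ   ≡⟨ +-assoc ‖ Γ ‖ (weight φ) (weight ψ) ⟩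
  ‖ Γ ‖ + (weight φ + weight ψ) <⟨ +-monoʳ-< ‖ Γ ‖ (weight-+-< (≺-⇒ˡ {φ} {ψ}) (≺-⇒ʳ {ψ} {φ})) ⟩
  ‖ Γ ‖ + weight (φ ⇒ ψ)        ≡⟨ μ-just Γ (φ ⇒ ψ) ⟨
  μ Γ (just (φ ⇒ ψ))            ∎
  where open ≤-Reasoning

-- From G3 to G4

-- The rules carry those premises of the G4 rule that inversion does not recover.
data LeftRule (L : Logic) (Γ : List Fm) : Set where
  ⊥L  : ⊥' ∈ Γ → LeftRule L Γ
  ∧L  : φ ∧ ψ ∈ Γ → LeftRule L Γ
  ∨L  : φ ∨ ψ ∈ Γ → LeftRule L Γ
  ∧⇒L : (φ ∧ ψ) ⇒ χ ∈ Γ → LeftRule L Γ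
  ∨⇒L : (φ ∨ ψ) ⇒ χ ∈ Γ → LeftRule L Γ
  p⇒L : var p ∈ Γ → var p ⇒ φ ∈ Γ → LeftRule L Γ
  ⇒⇒L : (φ ⇒ ψ) ⇒ χ ∈ Γ → G3 L Γ (just (φ ⇒ ψ)) → LeftRule L Γ
  □⇒L : □ φ ⇒ ψ ∈ Γ → G3 L (box⁻¹ Γ) (just φ) → LeftRule L Γ
  ◇⇒L : ◇ γ ∈ Γ → ◇ φ ⇒ ψ ∈ Γ → G3 L (γ ∷ box⁻¹ Γ) (just φ) → LeftRule L Γ

data G4Rule (L : Logic) (Γ : List Fm) : Maybe Fm → Set where
  left : LeftRule L Γ → G4Rule L Γ Δ
  IdP  : var p ∈ Γ → G4Rule L Γ (just (var p))
  ∧R   : G4Rule L Γ (just (φ ∧ ψ))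
  ⇒R   : G4Rule L Γ (just (φ ⇒ ψ))
  ∨R₁  : G3 L Γ (just φ) → G4Rule L Γ (just (φ ∨ ψ))
  ∨R₂  : G3 L Γ (just ψ) → G4Rule L Γ (just (φ ∨ ψ))
  □R   : G3 L (box⁻¹ Γ) (just φ) → G4Rule L Γ (just (□ φ))
  ◇L   : ◇ φ ∈ Γ → G3 L (φ ∷ box⁻¹ Γ) (dia⁻¹ Δ) → ◇L-Allowed L Δ → G4Rule L Γ Δ

-- The last rule of a G3-derivation determines a G4 rule, except for ⇒L on φ ⇒ ψ with φ
-- atomic, ⊥' or modal: there the G4 rule is found by looking at how φ itself was derived.
g4Rule : G3 L Γ Δ → G4Rule L Γ Δ
g4Rule (⊥L i)      = left (⊥L i)
g4Rule (Id i)      = IdP i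
g4Rule (∧L i _)    = left (∧L i)
g4Rule (∧R _ _)    = ∧R
g4Rule (∨L i _ _)  = left (∨L i)
g4Rule (∨R₁ d)     = ∨R₁ d
g4Rule (∨R₂ d)     = ∨R₂ d
g4Rule (⇒R _)      = ⇒R
g4Rule (□R d)      = □R d
g4Rule (◇L i d ok) = ◇L i d ok
g4Rule (⇒L {φ = _ ∧ _} i _ _) = left (∧⇒L i)
g4Rule (⇒L {φ = _ ∨ _} i _ _) = left (∨⇒L i)
g4Rule (⇒L {φ = _ ⇒ _} i d _) = left (⇒⇒L i d)
g4Rule (⇒L {φ = var _} i d _) with g4Rule d
... | left r             = left r
... | IdP j              = left (p⇒L j i)
... | ◇L j d' WK-any     = ◇L j (G3-weakenʳ d') WK-any
g4Rule (⇒L {φ = ⊥'} i d _) with g4Rule d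
... | left r             = left r
... | ◇L j d' WK-any     = ◇L j (G3-weakenʳ d') WK-any
g4Rule (⇒L {φ = □ _} i d _) with g4Rule d
... | left r             = left r
... | □R d'              = left (□⇒L i d')
... | ◇L j d' WK-any     = ◇L j (G3-weakenʳ d') WK-any
g4Rule (⇒L {φ = ◇ _} i d _) with g4Rule d
... | left r             = left r
... | ◇L j d' _          = left (◇⇒L j i d')

G3⇒G4-IH : Logic → List Fm → Maybe Fm → Set
G3⇒G4-IH L Γ Δ = ∀ {Γ' Δ'} → μ Γ' Δ' < μ Γ Δ → G3 L Γ' Δ' → G4 L Γ' Δ'

-- The premises of the G4 rule are G3-derivable by cut (inversion), and are smaller.
module _ {L Γ Δ} (ih : G3⇒G4-IH L Γ Δ) (d : G3 L Γ Δ) where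

  private
    replace₁ : Γ ↭ χ ∷ Γ₀ → G3 L (φ ∷ Γ₀) (just χ) → G3 L (φ ∷ Γ₀) Δ
    replace₁ ρ = G3-replace d (⊆-∷₂ (⊆-reflexive-↭ ρ))

    replace₂ : Γ ↭ χ ∷ Γ₀ → G3 L (φ ∷ ψ ∷ Γ₀) (just χ) → G3 L (φ ∷ ψ ∷ Γ₀) Δ
    replace₂ ρ = G3-replace d (⊆-∷₂ (⊆-∷₂ (⊆-reflexive-↭ ρ)))

    replace-2nd : Γ ↭ θ ∷ χ ∷ Γ₀ → G3 L (θ ∷ φ ∷ Γ₀) (just χ) → G3 L (θ ∷ φ ∷ Γ₀) Δ
    replace-2nd ρ = G3-replace d (⊆-trans (⊆-reflexive-↭ ρ) (⊆-∷-under (⊆-∷₂ ⊆-refl)))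

  left-rule⇒G4 : LeftRule L Γ → G4 L Γ Δ
  left-rule⇒G4 (⊥L i) with _ , ρ ← ∈⇒↭∷ i = ⊥L ρ
  left-rule⇒G4 (∧L i) with _ , ρ ← ∈⇒↭∷ i =
    ∧L ρ (ih (μ-<-replace₂ ρ ≺-∧ˡ ≺-∧ʳ) (replace₂ ρ (∧R (G3-id ∈₀) (G3-id ∈₁))))
  left-rule⇒G4 (∨L i) with _ , ρ ← ∈⇒↭∷ i =
    ∨L ρ (ih (μ-<-replace₁ ρ ≺-∨ˡ) (replace₁ ρ (∨R₁ (G3-id ∈₀))))
         (ih (μ-<-replace₁ ρ ≺-∨ʳ) (replace₁ ρ (∨R₂ (G3-id ∈₀))))
  left-rule⇒G4 (∧⇒L i) with _ , ρ ← ∈⇒↭∷ i =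
    ∧⇒L ρ (ih (μ-<-replace₁ ρ ≺-∧⇒)
                (replace₁ ρ (⇒R (∧L ∈₀ (⇒L ∈₃ (G3-id ∈₀) (⇒L ∈₀ (G3-id ∈₂) (G3-id ∈₀)))))))
  left-rule⇒G4 (∨⇒L i) with _ , ρ ← ∈⇒↭∷ i =
    ∨⇒L ρ (ih (μ-<-replace₂ ρ ≺-∨⇒ˡ ≺-∨⇒ʳ)
                (replace₂ ρ (⇒R (∨L ∈₀ (⇒L ∈₂ (G3-id ∈₀) (G3-id ∈₀)) (⇒L ∈₃ (G3-id ∈₀) (G3-id ∈₀))))))
  left-rule⇒G4 (p⇒L i j) with _ , ρ ← ∈₂⇒↭∷∷ i j (λ ()) =
    p⇒L ρ (ih (μ-<-replace-2nd ρ ≺-⇒ʳ) (replace-2nd ρ (⇒R (G3-id ∈₂))))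
  left-rule⇒G4 (⇒⇒L i e) with _ , ρ ← ∈⇒↭∷ i =
    ⇒⇒L ρ (ih (μ-<-replace-succ ρ ≺-⇒⇒ ≺-⇒ˡ)
                (⇒R (G3-replace (⇒R-inv e) (⊆-∷-under (⊆-∷₂ (⊆-reflexive-↭ ρ)))
                                (⇒R (⇒L ∈₀ (G3-id ∈₁) (⇒L ∈₃ (G3-id ∈₀) (G3-id ∈₀)))))))
          (ih (μ-<-replace₁ ρ ≺-⇒ʳ) (replace₁ ρ (⇒R (G3-id ∈₁))))
  left-rule⇒G4 (□⇒L i e) with _ , ρ ← ∈⇒↭∷ i =
    □⇒L ρ (ih (μ-<-□⇒L ρ (≺-trans ≺-□ ≺-⇒ˡ)) (G3-mono (box⁻¹-mono (⊆-reflexive-↭ ρ)) e))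
          (ih (μ-<-replace₁ ρ ≺-⇒ʳ) (replace₁ ρ (⇒R (G3-id ∈₁))))
  left-rule⇒G4 (◇⇒L i j e) with _ , ρ ← ∈₂⇒↭∷∷ i j (λ ()) =
    ◇⇒L ρ (ih (μ-<-◇⇒L ρ (≺-trans ≺-◇ ≺-⇒ˡ)) (G3-mono (∷⁺ʳ _ (box⁻¹-mono (⊆-reflexive-↭ ρ))) e))
          (ih (μ-<-replace-2nd ρ ≺-⇒ʳ) (replace-2nd ρ (⇒R (G3-id ∈₂))))

  g4Rule⇒G4 : G4Rule L Γ Δ → G4 L Γ Δ
  g4Rule⇒G4 (left r)  = left-rule⇒G4 r
  g4Rule⇒G4 (IdP i) with _ , ρ ← ∈⇒↭∷ i = IdP ρ
  g4Rule⇒G4 ∧R        = ∧R (ih (μ-<-just Γ Γ ≤-refl ≺-∧ˡ) (G3-cut d (∧L ∈₀ (G3-id ∈₀))))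
                           (ih (μ-<-just Γ Γ ≤-refl ≺-∧ʳ) (G3-cut d (∧L ∈₀ (G3-id ∈₁))))
  g4Rule⇒G4 ⇒R        = ⇒R (ih (μ-<-⇒R Γ) (⇒R-inv d))
  g4Rule⇒G4 (∨R₁ e)   = ∨R₁ (ih (μ-<-just Γ Γ ≤-refl ≺-∨ˡ) e)
  g4Rule⇒G4 (∨R₂ e)   = ∨R₂ (ih (μ-<-just Γ Γ ≤-refl ≺-∨ʳ) e)
  g4Rule⇒G4 (□R e)    = □R (ih (μ-<-just (box⁻¹ Γ) Γ (‖box⁻¹‖≤ Γ) ≺-□) e)
  g4Rule⇒G4 (◇L i e allowed) with _ , ρ ← ∈⇒↭∷ i =
    ◇L ρ (ih (μ-<-◇L ρ) (G3-mono (∷⁺ʳ _ (box⁻¹-mono (⊆-reflexive-↭ ρ))) e)) allowed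

G3⇒G4-acc : Acc _<_ (μ Γ Δ) → G3 L Γ Δ → G4 L Γ Δ
G3⇒G4-acc (acc below) d = g4Rule⇒G4 (λ lt → G3⇒G4-acc (below lt)) d (g4Rule d)

G3⇒G4 : G3 L Γ Δ → G4 L Γ Δ
G3⇒G4 = G3⇒G4-acc (<-wellFounded _)

theorem2 : ((Γ : List Fm) (φ : Fm) → G4CK Γ φ ⇔ CKH Γ φ)
         × ((Γ : List Fm) (Δ : Maybe Fm) → G4WK Γ Δ ⇔ WKH Γ (succ-fm Δ))
theorem2 = (λ Γ φ → mk⇔ (G4⇒H ∘ G4CK⇒G4) (G4⇒G4CK ∘ G3⇒G4 ∘ H⇒G3))
         , (λ Γ Δ → mk⇔ (G4⇒H ∘ G4WK⇒G4) (G4⇒G4WK ∘ G3⇒G4 ∘ H⇒G3-succ Δ))
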